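{- Let $d \geq 4$. There exists a collection of $4 + \lceil d/3 \rceil$ sets, each a union of ridges of $C^d$, covering every ridge of $C^d$, such that no set contains a pair of antipodal peaks.
   Context: $C^d=[0,1]^d$. A $k$-face of $C^d$ is given by a word in $\{0,1,X\}^d$ with exactly $k$ letters $X$ (the set of points agreeing with the word in the non-$X$, "fixed", positions). Two $k$-faces are antipodal iff they have exactly the same fixed positions and differ in every fixed position. A ridge is a $(d-2)$-face and a peak is a $(d-3)$-face. A set contains a pair of antipodal peaks if two antipodal peaks are both contained in it. -}

module Defs where

open import Data.Nat using (ℕ; zero; suc; _+_; _∸_)
open import Data.Nat.DivMod using (_/_)
open import Data.Fin using (Fin)
open import Data.Vec using (Vec; []; _∷_)
open import Data.Vec.Relation.Binary.Pointwise.Inductive using (Pointwise)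
open import Data.Bool using (Bool; T)
open import Data.Product using (Σ; ∃; _×_)
open import Data.Sum using (_⊎_)
open import Relation.Binary.PropositionalEquality using (_≡_)

-- Letters of a face word: fixed 0, fixed 1, or free X.
data Letter : Set where
  o : Letter
  i : Letter
  X : Letter

-- A face of C^d is a word in {0,1,X}^d.
Word : ℕ → Set
Word d = Vec Letter d

-- number of X letters = dimension of the face
numX : ∀ {d} → Word d → ℕ
numX [] = 0
numX (X ∷ w) = suc (numX w)
numX (o ∷ w) = numX w
numX (i ∷ w) = numX w

IsFace : ∀ {d} → ℕ → Word d → Set
IsFace k w = numX w ≡ k

IsRidge : ∀ {d} → Word d → Set
IsRidge {d} w = IsFace (d ∸ 2) w

IsPeak : ∀ {d} → Word d → Set
IsPeak {d} w = IsFace (d ∸ 3) w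

data AntiL : Letter → Letter → Set where
  XX : AntiL X X
  oi : AntiL o i
  io : AntiL i o

Antipodal : ∀ {d} → Word d → Word d → Set
Antipodal u v = Pointwise AntiL u v

-- face containment (as point sets): u ⊆ v iff v agrees with u at every
-- position where v is fixed
data SubL : Letter → Letter → Set where
  anyX : ∀ {a} → SubL a X
  same : ∀ {a} → SubL a a

_⊑_ : ∀ {d} → Word d → Word d → Set
u ⊑ v = Pointwise SubL u v

-- A set which is a union of ridges, given by the (decidable, finite) set
-- of ridges it is the union of.
RidgeSet : ℕ → Set
RidgeSet d = Word d → Bool

IsUnionOfRidges : ∀ {d} → RidgeSet d → Set
IsUnionOfRidges {d} S = (w : Word d) → T (S w) → IsRidge w

-- the face f is contained in the union of ridges S
-- (a face lies in a finite union of faces iff it lies in one of them)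
ContainsFace : ∀ {d} → RidgeSet d → Word d → Set
ContainsFace {d} S f = Σ (Word d) λ r → T (S r) × (f ⊑ r)

CoversRidge : ∀ {d} → RidgeSet d → Word d → Set
CoversRidge S r = ContainsFace S r

ContainsAntipodalPeaks : ∀ {d} → RidgeSet d → Set
ContainsAntipodalPeaks {d} S =
  Σ (Word d) λ p → Σ (Word d) λ q →
    IsPeak p × IsPeak q × Antipodal p q × ContainsFace S p × ContainsFace S q

⌈_/3⌉ : ℕ → ℕ
⌈ n /3⌉ = (n + 2) / 3

-- Each set is the star of a vertex s: all ridges through s. Two ridges r₁, r₂ through a common
-- vertex cannot contain antipodal peaks p ⊆ r₁, q ⊆ r₂: in each coordinate where p and q are
-- fixed (and hence differ) r₁ and r₂ cannot both be fixed, as both would agree with s there, so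
-- d + dim p ≤ dim r₁ + dim r₂, which fails for peaks and ridges. A ridge is fixed in only two
-- coordinates, so the stars cover all ridges as soon as every pair of coordinates sees all four
-- 0/1-patterns among the chosen vertices. Arranging the coordinates in a 3 × ⌈d/3⌉ grid, this
-- is achieved by the zero vertex, the three vertices vanishing exactly on one grid row, and the
-- ⌈d/3⌉ vertices vanishing exactly on one grid column.
module Submission where

open import Defs
open import Data.Bool using (Bool; true; false; not)
open import Data.Empty using (⊥-elim)
open import Data.Fin using (Fin; zero; suc; toℕ; fromℕ<; splitAt; _↑ˡ_; _↑ʳ_)
open import Data.Fin.Properties as Finₚ using (fromℕ<-injective; toℕ-injective; toℕ<n; splitAt-↑ˡ)
  renaming (_≟_ to _≟ᶠ_)
open import Data.Nat using (ℕ; zero; suc; _+_; _*_; _∸_; _≤_; _<_; z≤n; s≤s; NonZero)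
open import Data.Nat.DivMod using (_/_; _%_; _mod_; m≡m%n+[m/n]*n; m%n<n; m/n≡1+[m∸n]/n; /-monoˡ-≤)
open import Data.Nat.Properties
  using (≤-refl; ≤-trans; ≤-pred; m≤n⇒m≤1+n; 1+n≰n; +-mono-≤; +-monoʳ-≤; +-comm; +-suc; suc-injective;
         m+[n∸m]≡n; +-commutativeSemigroup; _≟_)
open import Algebra.Properties.CommutativeSemigroup +-commutativeSemigroup using (interchange)
open import Data.Product using (Σ; ∃; _×_; _,_; proj₂)
open import Data.Sum using ([_,_]′)
open import Data.Vec using ([]; _∷_; lookup; tabulate)
open import Data.Vec.Relation.Binary.Pointwise.Inductive using ([]; _∷_; decidable)
open import Function using (_∘_)
open import Relation.Nullary using (¬_; Dec; yes; no; does)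
open import Relation.Nullary.Decidable using (⌊_⌋; toWitness; fromWitness; _×-dec_; dec-true; dec-false)
open import Relation.Binary.PropositionalEquality
  using (_≡_; _≢_; refl; sym; trans; cong; cong₂; cong-app; subst; subst₂; module ≡-Reasoning)

_⊑ₗ?_ : (a b : Letter) → Dec (SubL a b)
a ⊑ₗ? X = yes anyX
o ⊑ₗ? o = yes same
i ⊑ₗ? i = yes same
o ⊑ₗ? i = no λ ()
i ⊑ₗ? o = no λ ()
X ⊑ₗ? o = no λ ()
X ⊑ₗ? i = no λ ()

_⊑?_ : ∀ {n} (u v : Word n) → Dec (u ⊑ v)
u ⊑? v = decidable _⊑ₗ?_ u v

⊑-refl : ∀ {n} (r : Word n) → r ⊑ r
⊑-refl [] = []
⊑-refl (_ ∷ r) = same ∷ ⊑-refl r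

tabulate-⊑ : ∀ {n} {f : Fin n → Letter} (r : Word n) →
             (∀ k → SubL (f k) (lookup r k)) → tabulate f ⊑ r
tabulate-⊑ [] f⊑r = []
tabulate-⊑ (_ ∷ r) f⊑r = f⊑r zero ∷ tabulate-⊑ r (f⊑r ∘ suc)

bit : Bool → Letter
bit false = o
bit true = i

vertex : ∀ {n} → (Fin n → Bool) → Word n
vertex v = tabulate (bit ∘ v)

bit-⊑ : (a : Letter) → ∃ λ x → SubL (bit x) a
bit-⊑ o = false , same
bit-⊑ i = true , same
bit-⊑ X = false , anyX

star : ∀ {d} → Word d → RidgeSet d
star {d} s r = ⌊ (s ⊑? r) ×-dec (numX r ≟ d ∸ 2) ⌋

star-isUnionOfRidges : ∀ {d} (s : Word d) → IsUnionOfRidges (star s)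
star-isUnionOfRidges s r r∈star = proj₂ (toWitness r∈star)

dimₗ : Letter → ℕ
dimₗ X = 1
dimₗ o = 0
dimₗ i = 0

numX-∷ : ∀ {n} a (w : Word n) → numX (a ∷ w) ≡ dimₗ a + numX w
numX-∷ X w = refl
numX-∷ o w = refl
numX-∷ i w = refl

antipodalₗ-dim : ∀ {s p q r₁ r₂} → SubL s r₁ → SubL s r₂ → SubL p r₁ → SubL q r₂ →
                 AntiL p q → 1 + dimₗ p ≤ dimₗ r₁ + dimₗ r₂
antipodalₗ-dim _ _ anyX anyX XX = ≤-refl
antipodalₗ-dim _ _ anyX same XX = ≤-refl
antipodalₗ-dim _ _ same anyX XX = ≤-refl
antipodalₗ-dim _ _ same same XX = ≤-refl
antipodalₗ-dim _ _ anyX anyX oi = s≤s z≤n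
antipodalₗ-dim _ _ anyX same oi = s≤s z≤n
antipodalₗ-dim _ _ same anyX oi = s≤s z≤n
antipodalₗ-dim same () same same oi
antipodalₗ-dim _ _ anyX anyX io = s≤s z≤n
antipodalₗ-dim _ _ anyX same io = s≤s z≤n
antipodalₗ-dim _ _ same anyX io = s≤s z≤n
antipodalₗ-dim same () same same io

antipodal-dim : ∀ {n} {s p q r₁ r₂ : Word n} → s ⊑ r₁ → s ⊑ r₂ → p ⊑ r₁ → q ⊑ r₂ →
                Antipodal p q → n + numX p ≤ numX r₁ + numX r₂
antipodal-dim [] [] [] [] [] = z≤n
antipodal-dim {suc n} {p = p ∷ ps} {r₁ = r₁ ∷ r₁s} {r₂ ∷ r₂s}
              (s₁ ∷ ss₁) (s₂ ∷ ss₂) (p₁ ∷ ps₁) (q₂ ∷ qs₂) (pq ∷ pqs) =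
  subst₂ _≤_ lhs rhs
    (+-mono-≤ (antipodalₗ-dim s₁ s₂ p₁ q₂ pq) (antipodal-dim ss₁ ss₂ ps₁ qs₂ pqs))
  where
  lhs : (1 + dimₗ p) + (n + numX ps) ≡ suc n + numX (p ∷ ps)
  lhs = trans (interchange 1 (dimₗ p) n (numX ps)) (cong (suc n +_) (sym (numX-∷ p ps)))
  rhs : (dimₗ r₁ + dimₗ r₂) + (numX r₁s + numX r₂s) ≡ numX (r₁ ∷ r₁s) + numX (r₂ ∷ r₂s)
  rhs = trans (interchange (dimₗ r₁) (dimₗ r₂) (numX r₁s) (numX r₂s))
              (sym (cong₂ _+_ (numX-∷ r₁ r₁s) (numX-∷ r₂ r₂s)))

star-noAntipodalPeaks : ∀ {d} → 3 ≤ d → (s : Word d) → ¬ ContainsAntipodalPeaks (star s)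
star-noAntipodalPeaks {suc (suc (suc e))} (s≤s (s≤s (s≤s _))) s
  (p , q , p-peak , _ , p⇔q , (r₁ , r₁∈star , p⊑r₁) , (r₂ , r₂∈star , q⊑r₂))
  with toWitness r₁∈star | toWitness r₂∈star
... | s⊑r₁ , r₁-ridge | s⊑r₂ , r₂-ridge =
  1+n≰n (≤-pred (≤-pred (subst (3 + e + e ≤_) (cong suc (+-suc e e)) dims)))
  where
  dims : 3 + e + e ≤ suc e + suc e
  dims = subst₂ _≤_ (cong (3 + e +_) p-peak) (cong₂ _+_ r₁-ridge r₂-ridge)
           (antipodal-dim s⊑r₁ s⊑r₂ p⊑r₁ q⊑r₂ p⇔q)

numX≤length : ∀ {n} (w : Word n) → numX w ≤ n
numX≤length [] = z≤n
numX≤length (X ∷ w) = s≤s (numX≤length w)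
numX≤length (o ∷ w) = m≤n⇒m≤1+n (numX≤length w)
numX≤length (i ∷ w) = m≤n⇒m≤1+n (numX≤length w)

numX≢1+length : ∀ {n} (w : Word n) → numX w ≢ suc n
numX≢1+length w eq = 1+n≰n (subst (_≤ _) eq (numX≤length w))

full-X : ∀ {n} (w : Word n) → numX w ≡ n → ∀ k → lookup w k ≡ X
full-X (X ∷ w) eq zero = refl
full-X (X ∷ w) eq (suc k) = full-X w (suc-injective eq) k
full-X (o ∷ w) eq k = ⊥-elim (numX≢1+length w eq)
full-X (i ∷ w) eq k = ⊥-elim (numX≢1+length w eq)

one-fixed : ∀ {n} (w : Word n) → suc (numX w) ≡ n →
            ∃ λ a → ∀ k → k ≢ a → lookup w k ≡ X
one-fixed (X ∷ w) eq with one-fixed w (suc-injective eq)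
... | a , rest = suc a , λ { zero _ → refl ; (suc k) k≢a → rest k (k≢a ∘ cong suc) }
one-fixed (o ∷ w) eq =
  zero , λ { zero 0≢0 → ⊥-elim (0≢0 refl) ; (suc k) _ → full-X w (suc-injective eq) k }
one-fixed (i ∷ w) eq =
  zero , λ { zero 0≢0 → ⊥-elim (0≢0 refl) ; (suc k) _ → full-X w (suc-injective eq) k }

two-fixed : ∀ {n} (w : Word n) → 2 + numX w ≡ n →
            ∃ λ a → ∃ λ b → a ≢ b × (∀ k → k ≢ a → k ≢ b → lookup w k ≡ X)
two-fixed (X ∷ w) eq with two-fixed w (suc-injective eq)
... | a , b , a≢b , rest =
  suc a , suc b , a≢b ∘ Finₚ.suc-injective ,
  λ { zero _ _ → refl ; (suc k) k≢a k≢b → rest k (k≢a ∘ cong suc) (k≢b ∘ cong suc) }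
two-fixed (o ∷ w) eq with one-fixed w (suc-injective eq)
... | b , rest = zero , suc b , (λ ()) ,
  λ { zero 0≢0 _ → ⊥-elim (0≢0 refl) ; (suc k) _ k≢b → rest k (k≢b ∘ cong suc) }
two-fixed (i ∷ w) eq with one-fixed w (suc-injective eq)
... | b , rest = zero , suc b , (λ ()) ,
  λ { zero 0≢0 _ → ⊥-elim (0≢0 refl) ; (suc k) _ k≢b → rest k (k≢b ∘ cong suc) }

CoversPairs : ∀ {m n} → (Fin m → Fin n → Bool) → Set
CoversPairs {n = n} V = ∀ {a b : Fin n} → a ≢ b → ∀ x y → ∃ λ j → V j a ≡ x × V j b ≡ y

stars-coverRidges : ∀ {m n} {V : Fin m → Fin n → Bool} → CoversPairs V → 2 ≤ n →
                    (r : Word n) → IsRidge r → ∃ λ j → CoversRidge (star (vertex (V j))) r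
stars-coverRidges {V = V} coversPairs 2≤n r r-ridge
  with two-fixed r (trans (cong (2 +_) r-ridge) (m+[n∸m]≡n 2≤n))
... | a , b , a≢b , rest
  with bit-⊑ (lookup r a) | bit-⊑ (lookup r b)
... | x , x⊑ra | y , y⊑rb
  with coversPairs a≢b x y
... | j , Vja≡x , Vjb≡y = j , r , fromWitness (tabulate-⊑ r Vj⊑r , r-ridge) , ⊑-refl r
  where
  Vj⊑r : ∀ k → SubL (bit (V j k)) (lookup r k)
  Vj⊑r k with k ≟ᶠ a | k ≟ᶠ b
  ... | yes refl | _ = subst (λ z → SubL (bit z) (lookup r k)) (sym Vja≡x) x⊑ra
  ... | no _ | yes refl = subst (λ z → SubL (bit z) (lookup r k)) (sym Vjb≡y) y⊑rb
  ... | no k≢a | no k≢b = subst (SubL (bit (V j k))) (sym (rest k k≢a k≢b)) anyX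

differs : ∀ {k} → Fin k → Fin k → Bool
differs s t = not (does (s ≟ᶠ t))

differs-refl : ∀ {k} (t : Fin k) → differs t t ≡ false
differs-refl t = cong not (dec-true (t ≟ᶠ t) refl)

differs-≢ : ∀ {k} {s t : Fin k} → s ≢ t → differs s t ≡ true
differs-≢ {s = s} {t} s≢t = cong not (dec-false (s ≟ᶠ t) s≢t)

avoid-two : (s t : Fin 3) → ∃ λ u → u ≢ s × u ≢ t
avoid-two zero zero = suc zero , (λ ()) , (λ ())
avoid-two zero (suc zero) = suc (suc zero) , (λ ()) , (λ ())
avoid-two zero (suc (suc zero)) = suc zero , (λ ()) , (λ ())
avoid-two (suc zero) zero = suc (suc zero) , (λ ()) , (λ ())
avoid-two (suc zero) (suc zero) = zero , (λ ()) , (λ ())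
avoid-two (suc zero) (suc (suc zero)) = zero , (λ ()) , (λ ())
avoid-two (suc (suc zero)) zero = suc zero , (λ ()) , (λ ())
avoid-two (suc (suc zero)) (suc zero) = zero , (λ ()) , (λ ())
avoid-two (suc (suc zero)) (suc (suc zero)) = zero , (λ ()) , (λ ())

module Grid {n G : ℕ} (row : Fin n → Fin 3) (column : Fin n → Fin G) where

  rowVertex : Fin 3 → Fin n → Bool
  rowVertex t a = differs (row a) t

  columnVertex : Fin G → Fin n → Bool
  columnVertex g a = differs (column a) g

  gridVertices : Fin (4 + G) → Fin n → Bool
  gridVertices zero _ = false
  gridVertices (suc j) = [ rowVertex , columnVertex ]′ (splitAt 3 j)

  gridVertices-row : ∀ t → gridVertices (suc (t ↑ˡ G)) ≡ rowVertex t
  gridVertices-row t = cong [ rowVertex , columnVertex ]′ (splitAt-↑ˡ 3 t G)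

  gridVertices-coversPairs : (∀ {a b} → row a ≡ row b → column a ≡ column b → a ≡ b) →
                             CoversPairs gridVertices
  gridVertices-coversPairs grid-injective = covers
    where
    fromRow : ∀ t {a b x y} → rowVertex t a ≡ x → rowVertex t b ≡ y →
              ∃ λ j → gridVertices j a ≡ x × gridVertices j b ≡ y
    fromRow t {a} {b} ta tb = suc (t ↑ˡ G) ,
      trans (cong-app (gridVertices-row t) a) ta , trans (cong-app (gridVertices-row t) b) tb

    zero-one : ∀ {a b} → a ≢ b → ∃ λ j → gridVertices j a ≡ false × gridVertices j b ≡ true
    zero-one {a} {b} a≢b with row a ≟ᶠ row b
    ... | no ra≢rb = fromRow (row a) (differs-refl (row a)) (differs-≢ (ra≢rb ∘ sym))
    ... | yes ra≡rb = suc (3 ↑ʳ column a) , differs-refl (column a) ,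
                      differs-≢ (λ cb≡ca → a≢b (grid-injective ra≡rb (sym cb≡ca)))

    covers : CoversPairs gridVertices
    covers a≢b false false = zero , refl , refl
    covers {a} {b} a≢b true true with avoid-two (row a) (row b)
    ... | t , t≢ra , t≢rb = fromRow t (differs-≢ (t≢ra ∘ sym)) (differs-≢ (t≢rb ∘ sym))
    covers a≢b false true = zero-one a≢b
    covers a≢b true false with zero-one (a≢b ∘ sym)
    ... | j , jb , ja = j , ja , jb

%-/-injective : ∀ {m m′} n .{{_ : NonZero n}} → m % n ≡ m′ % n → m / n ≡ m′ / n → m ≡ m′
%-/-injective {m} {m′} n m%n≡m′%n m/n≡m′/n = begin
  m                    ≡⟨ m≡m%n+[m/n]*n m n ⟩
  m % n + m / n * n    ≡⟨ cong₂ (λ r q → r + q * n) m%n≡m′%n m/n≡m′/n ⟩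
  m′ % n + m′ / n * n  ≡⟨ sym (m≡m%n+[m/n]*n m′ n) ⟩
  m′                   ∎
  where open ≡-Reasoning

column-bound : ∀ {d} (a : Fin d) → toℕ a / 3 < ⌈ d /3⌉
column-bound {d} a = subst (_≤ ⌈ d /3⌉) (m/n≡1+[m∸n]/n {3 + toℕ a} (s≤s (s≤s (s≤s z≤n))))
  (/-monoˡ-≤ 3 (subst (3 + toℕ a ≤_) (+-comm 2 d) (+-monoʳ-≤ 2 (toℕ<n a))))

row : ∀ {d} → Fin d → Fin 3
row a = toℕ a mod 3

column : ∀ {d} → Fin d → Fin ⌈ d /3⌉
column a = fromℕ< (column-bound a)

row-column-injective : ∀ {d} {a b : Fin d} → row a ≡ row b → column a ≡ column b → a ≡ b
row-column-injective {a = a} {b} ra≡rb ca≡cb = toℕ-injective (%-/-injective 3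
  (fromℕ<-injective _ _ (m%n<n (toℕ a) 3) (m%n<n (toℕ b) 3) ra≡rb)
  (fromℕ<-injective _ _ (column-bound a) (column-bound b) ca≡cb))

lemma9 : (d : ℕ) → 4 ≤ d →
    Σ (Fin (4 + ⌈ d /3⌉) → RidgeSet d) λ S →
      ((j : Fin (4 + ⌈ d /3⌉)) → IsUnionOfRidges (S j))
      × ((r : Word d) → IsRidge r → Σ (Fin (4 + ⌈ d /3⌉)) λ j → CoversRidge (S j) r)
      × ((j : Fin (4 + ⌈ d /3⌉)) → ¬ ContainsAntipodalPeaks (S j))
lemma9 d 4≤d =
  S ,
  (λ j → star-isUnionOfRidges (vertex (gridVertices j))) ,
  stars-coverRidges (gridVertices-coversPairs row-column-injective) 2≤d ,
  (λ j → star-noAntipodalPeaks 3≤d (vertex (gridVertices j)))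
  where
  open Grid {d} {⌈ d /3⌉} row column
  S : Fin (4 + ⌈ d /3⌉) → RidgeSet d
  S j = star (vertex (gridVertices j))
  3≤d : 3 ≤ d
  3≤d = ≤-trans (s≤s (s≤s (s≤s z≤n))) 4≤d
  2≤d : 2 ≤ d
  2≤d = ≤-trans (s≤s (s≤s z≤n)) 3≤d
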